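{- Let $T$ be a rooted tree with leaf set $\mathcal{S}$ and no subdivision node, and let $\mathcal{C}$ be a set of characters on $\mathcal{S}$ such that $T$ is galled-completable for $\mathcal{C}$. Suppose that there exist two distinct characters $A,B\in\mathcal{C}$ with $\mathrm{FA}_T(A)=\{a_1,a_2\}$ and $\mathrm{FA}_T(B)=\{b_1,b_2\}$. Then: (1) if $b_1\prec_T a_1$ and $b_2$ is not comparable to $a_1$ in $T$, then $a_2=b_2$; (2) if $a_1=b_1$, then either $b_2\prec_T a_2$ or $a_2\prec_T b_2$.
   Context: A network is a finite directed acyclic graph with a unique node of in-degree $0$ (the root); a leaf has in-degree $1$ and out-degree $0$; subdivision nodes are allowed. An underlying cycle is a cycle of the underlying undirected (multi)graph; two are distinct if they use different edge sets. A network is a galled tree if no two distinct underlying cycles share a node. A tree is a network with no underlying cycle; $u\preceq_T v$ means $v$ is on the path from the root to $u$ (reflexive), $u\prec_T v$ means $u\preceq_T v$ and $u\ne v$; $L_T(v)$ is the set of leaves descending from $v$. An LGT network is a network $N=(V,E_S\cup E_T)$ with a specified partition of its edges into support edges $E_S$ and transfer edges $E_T$ such that $(V,E_S)$ is a tree $\overline{N}$ (the support tree), both endpoints of every transfer edge are incomparable in $\overline{N}$, and every endpoint of a transfer edge has exactly one child in $\overline{N}$. The base tree of $N$ is obtained from $\overline{N}$ by suppressing subdivision nodes. A character is a subset of $\mathcal{S}$; $F_C(N)$ is the set of nodes $v$ such that some leaf descending from $v$ in $\overline{N}$ is not in $C$; $N$ explains $\mathcal{C}$ if for every $C\in\mathcal{C}$,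 $N-F_C(N)$ contains a node reaching every leaf of $C$ within $N-F_C(N)$. $T$ is galled-completable for $\mathcal{C}$ if some LGT network that is a galled tree, has leaf set $\mathcal{S}$ and base tree $T$, explains $\mathcal{C}$. A node $v$ of $T$ is a first-appearance (FA) node for $C$ if $L_T(v)\subseteq C$ and either $v$ is the root or its parent $u$ satisfies $L_T(u)\not\subseteq C$; $\mathrm{FA}_T(C)$ is the set of such nodes. -}

module Defs where

open import Data.Nat using (ℕ; zero; suc)
open import Data.Fin using (Fin; zero; suc; _≟_)
open import Data.Fin.Subset using (Subset; _∈_; _∉_)
open import Data.List using (List; length; filter; lookup; allFin)
open import Data.Bool using (Bool; T; T?)
open import Data.Product using (Σ; ∃; _×_; _,_)
open import Data.Sum using (_⊎_)
open import Relation.Nullary using (¬_)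
open import Relation.Binary.PropositionalEquality using (_≡_; _≢_)

record Digraph : Set where
  field
    nV  : ℕ
    nE  : ℕ
    src : Fin nE → Fin nV
    tgt : Fin nE → Fin nV

open Digraph public

Node : Digraph → Set
Node G = Fin (nV G)

restrict : (G : Digraph) → (Fin (nE G) → Bool) → Digraph
restrict G sel = record
  { nV  = nV G
  ; nE  = length kept
  ; src = λ i → src G (lookup kept i)
  ; tgt = λ i → tgt G (lookup kept i)
  }
  where
  kept : List (Fin (nE G))
  kept = filter (λ e → T? (sel e)) (allFin (nE G))

indeg : (G : Digraph) → Node G → ℕ
indeg G v = length (filter (λ e → tgt G e ≟ v) (allFin (nE G)))

outdeg : (G : Digraph) → Node G → ℕ
outdeg G v = length (filter (λ e → src G e ≟ v) (allFin (nE G)))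

IsLeaf : (G : Digraph) → Node G → Set
IsLeaf G v = (indeg G v ≡ 1) × (outdeg G v ≡ 0)

IsSubdiv : (G : Digraph) → Node G → Set
IsSubdiv G v = (indeg G v ≡ 1) × (outdeg G v ≡ 1)

Edge : (G : Digraph) → Node G → Node G → Set
Edge G u v = ∃ λ e → (src G e ≡ u) × (tgt G e ≡ v)

data ReachIn (G : Digraph) (P : Node G → Set) : Node G → Node G → Set where
  here : ∀ {u} → P u → ReachIn G P u u
  step : ∀ {u v} (e : Fin (nE G)) → P u → src G e ≡ u →
         ReachIn G P (tgt G e) v → ReachIn G P u v

data Reach (G : Digraph) : Node G → Node G → Set where
  here : ∀ {u} → Reach G u u
  step : ∀ {u v} (e : Fin (nE G)) → src G e ≡ u →
         Reach G (tgt G e) v → Reach G u v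

data Reach⁺ (G : Digraph) : Node G → Node G → Set where
  step : ∀ {u v} (e : Fin (nE G)) → src G e ≡ u →
         Reach G (tgt G e) v → Reach⁺ G u v

IsRoot : (G : Digraph) → Node G → Set
IsRoot G v = indeg G v ≡ 0

IsNetwork : Digraph → Set
IsNetwork G =
  (∀ u → ¬ Reach⁺ G u u) ×
  (∃ λ r → IsRoot G r × (∀ v → IsRoot G v → v ≡ r))

-- cyclic successor on Fin (suc k)
next : ∀ {k} → Fin (suc k) → Fin (suc k)
next {zero}  zero    = zero
next {suc k} zero    = suc zero
next {suc k} (suc i) = wrap (next {k} i)
  where
  wrap : Fin (suc k) → Fin (suc (suc k))
  wrap zero    = zero
  wrap (suc j) = suc (suc j)

Joins : (G : Digraph) → Fin (nE G) → Node G → Node G → Set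
Joins G e x y = ((src G e ≡ x) × (tgt G e ≡ y)) ⊎ ((src G e ≡ y) × (tgt G e ≡ x))

record UCycle (G : Digraph) : Set where
  field
    len    : ℕ
    vs     : Fin (suc len) → Node G
    es     : Fin (suc len) → Fin (nE G)
    vs-inj : ∀ i j → vs i ≡ vs j → i ≡ j
    es-inj : ∀ i j → es i ≡ es j → i ≡ j
    joins  : ∀ i → Joins G (es i) (vs i) (vs (next i))

open UCycle public

UsesEdge : {G : Digraph} → UCycle G → Fin (nE G) → Set
UsesEdge c e = ∃ λ i → es c i ≡ e

UsesNode : {G : Digraph} → UCycle G → Node G → Set
UsesNode c v = ∃ λ i → vs c i ≡ v

DistinctCycles : {G : Digraph} → UCycle G → UCycle G → Set
DistinctCycles c d =
  (∃ λ e → UsesEdge c e × ¬ UsesEdge d e) ⊎ (∃ λ e → UsesEdge d e × ¬ UsesEdge c e)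

ShareNode : {G : Digraph} → UCycle G → UCycle G → Set
ShareNode c d = ∃ λ v → UsesNode c v × UsesNode d v

IsGalledTree : Digraph → Set
IsGalledTree G = IsNetwork G × (∀ (c d : UCycle G) → DistinctCycles c d → ¬ ShareNode c d)

IsTree : Digraph → Set
IsTree G = IsNetwork G × ¬ UCycle G

-- Leaf sets: species are Fin s; lab assigns to each species its leaf

HasLeafSet : (G : Digraph) (s : ℕ) → (Fin s → Node G) → Set
HasLeafSet G s lab =
  (∀ i → IsLeaf G (lab i)) ×
  (∀ i j → lab i ≡ lab j → i ≡ j) ×
  (∀ v → IsLeaf G v → ∃ λ i → lab i ≡ v)

-- LGT networks: sel e = true  iff  e is a support edge

SupportTree : (G : Digraph) → (Fin (nE G) → Bool) → Digraph
SupportTree G sel = restrict G sel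

IsLGT : (G : Digraph) → (Fin (nE G) → Bool) → Set
IsLGT G sel =
  IsNetwork G ×
  IsTree (SupportTree G sel) ×
  (∀ e → ¬ T (sel e) →
      ¬ Reach (SupportTree G sel) (src G e) (tgt G e) ×
      ¬ Reach (SupportTree G sel) (tgt G e) (src G e) ×
      outdeg (SupportTree G sel) (src G e) ≡ 1 ×
      outdeg (SupportTree G sel) (tgt G e) ≡ 1)

-- path in S of length ≥ 1 from u to v whose internal nodes are all
-- subdivision nodes of S (i.e. an edge after suppressing subdivision nodes)
data SuppressedEdge (S : Digraph) : Node S → Node S → Set where
  direct : ∀ {u v} → Edge S u v → SuppressedEdge S u v
  via    : ∀ {u w v} → Edge S u w → IsSubdiv S w →
           SuppressedEdge S w v → SuppressedEdge S u v

-- T (with leaf labelling labT) is, as a leaf-labelled tree, the tree obtained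
-- from S (leaf labelling labS) by suppressing all subdivision nodes:
-- φ identifies the nodes of T with the non-subdivision nodes of S, preserving
-- leaf labels, and edges of T correspond to suppressed paths of S.
IsSuppressionOf : (T' : Digraph) (s : ℕ) (labT : Fin s → Node T')
                  (S : Digraph) (labS : Fin s → Node S) → Set
IsSuppressionOf T' s labT S labS =
  ∃ λ (φ : Node T' → Node S) →
    (∀ x y → φ x ≡ φ y → x ≡ y) ×
    (∀ x → ¬ IsSubdiv S (φ x)) ×
    (∀ v → ¬ IsSubdiv S v → ∃ λ x → φ x ≡ v) ×
    (∀ i → φ (labT i) ≡ labS i) ×
    (∀ x y → (Edge T' x y → SuppressedEdge S (φ x) (φ y)) ×
             (SuppressedEdge S (φ x) (φ y) → Edge T' x y))

Character : ℕ → Set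
Character s = Subset s

InF : (G : Digraph) (sel : Fin (nE G) → Bool) {s : ℕ} (lab : Fin s → Node G) →
      Character s → Node G → Set
InF G sel lab C v = ∃ λ i → Reach (SupportTree G sel) v (lab i) × i ∉ C

ExplainsChar : (G : Digraph) (sel : Fin (nE G) → Bool) {s : ℕ} (lab : Fin s → Node G) →
               Character s → Set
ExplainsChar G sel lab C =
  ∃ λ w → ¬ InF G sel lab C w ×
    (∀ i → i ∈ C → ReachIn G (λ v → ¬ InF G sel lab C v) w (lab i))

GalledCompletable : (T' : Digraph) (s : ℕ) (labT : Fin s → Node T') →
                    (Character s → Set) → Set
GalledCompletable T' s labT 𝒞 =
  Σ Digraph λ G → Σ (Fin (nE G) → Bool) λ sel → Σ (Fin s → Node G) λ lab →
    IsLGT G sel × IsGalledTree G × HasLeafSet G s lab ×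
    IsSuppressionOf T' s labT (SupportTree G sel) lab ×
    (∀ C → 𝒞 C → ExplainsChar G sel lab C)

-- u ⪯_T v (v lies on the path from the root to u) is  Reach G v u.
Prec : (G : Digraph) → Node G → Node G → Set
Prec G u v = Reach G v u × u ≢ v

Comparable : (G : Digraph) → Node G → Node G → Set
Comparable G u v = Reach G v u ⊎ Reach G u v

LeavesWithin : (G : Digraph) {s : ℕ} (lab : Fin s → Node G) → Node G → Character s → Set
LeavesWithin G lab v C = ∀ i → Reach G v (lab i) → i ∈ C

IsFA : (G : Digraph) {s : ℕ} (lab : Fin s → Node G) → Character s → Node G → Set
IsFA G lab C v =
  LeavesWithin G lab v C ×
  (IsRoot G v ⊎ (∃ λ u → Edge G u v × ¬ LeavesWithin G lab u C))

FAIsPair : (G : Digraph) {s : ℕ} (lab : Fin s → Node G) → Character s →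
           Node G → Node G → Set
FAIsPair G lab C x y =
  ∀ v → (IsFA G lab C v → (v ≡ x ⊎ v ≡ y)) × ((v ≡ x ⊎ v ≡ y) → IsFA G lab C v)

-- Let G be an LGT network that is a galled tree, with support tree S, and let the
-- support edge p → z enter the subtree of S below z. A transfer edge with exactly
-- one end in that subtree closes, with support paths and p → z, an underlying cycle
-- through p; two such edges would give two distinct cycles sharing p, so every such
-- subtree is crossed by at most one transfer edge.
--
-- For a character C with FA_T(C) = {c₁, c₂}, the nodes outside F_C lie in the two
-- disjoint subtrees D₁, D₂ below the highest such nodes above c₁ and c₂, and the
-- path explaining C must pass between them, through the unique transfer edge
-- crossing D₁. For two characters A and B the hypotheses of (1) and of (2) force
-- these edges to coincide. In (1), following the explanation of A or B past this
-- edge to a suitable leaf would require a second crossing of some subtree unless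
-- a₂ = b₂. In (2) the edge ends in D₂ of both characters, so a₂ and b₂ are
-- comparable, and a₂ ≠ b₂ because A ≠ B.

module Submission where

open import Defs
open import Data.Nat using (ℕ; zero; suc; _≤_; _<_; z≤n; s≤s; _+_)
import Data.Nat as ℕ
import Data.Nat.Properties as ℕₚ
open import Data.Fin using (Fin; zero; suc; _≟_)
import Data.Fin as Fin
open import Data.Fin.Properties using (any?; all?; pigeonhole)
open import Data.Fin.Subset using (_∈_; _⊆_)
open import Data.Fin.Subset.Properties using (_∈?_; ⊆-antisym)
open import Data.List using (List; []; _∷_; length; filter; lookup; allFin; map)
import Data.List as List
open import Data.List.Membership.Propositional using () renaming (_∈_ to _∈ₗ_; _∉_ to _∉ₗ_)
open import Data.List.Membership.Propositional.Properties
  using (∈-allFin; ∈-filter⁺; ∈-filter⁻; ∈-length; ∈-lookup; ∈-map⁺; ∈-map⁻)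
open import Data.List.Relation.Unary.Any as Any using (here; there)
open import Data.List.Relation.Unary.Any.Properties using (lookup-index)
open import Data.List.Relation.Unary.AllPairs using ([]; _∷_)
open import Data.List.Relation.Unary.All using (_∷_)
open import Data.List.Relation.Unary.All.Properties using (¬Any⇒All¬; All¬⇒¬Any)
open import Data.List.Relation.Unary.Unique.Propositional using (Unique)
open import Data.List.Relation.Unary.Unique.Propositional.Properties using (allFin⁺; filter⁺)
open import Data.Bool using (Bool; T?) renaming (T to True)
open import Data.Product using (Σ; ∃; _×_; _,_; proj₁; proj₂)
open import Data.Sum using (_⊎_; inj₁; inj₂; swap)
open import Data.Empty using (⊥; ⊥-elim)
open import Data.Unit using (⊤; tt)
open import Relation.Nullary using (¬_; Dec; yes; no; ¬?; _×-dec_; _→-dec_)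
open import Relation.Nullary.Decidable using (decidable-stable)
open import Relation.Unary using (Pred; Decidable; _∩_)
open import Level using (Level; _⊔_)
open import Function using (_∘_)
open import Relation.Binary.PropositionalEquality using (_≡_; _≢_; refl; sym; trans; cong; subst)

private
  variable
    a b : Level
    A : Set a
    B : Set b

nonempty⇒∈ : ∀ {xs : List A} → 0 < length xs → ∃ λ x → x ∈ₗ xs
nonempty⇒∈ {xs = x ∷ _} _ = x , here refl

length≤1⇒≡ : ∀ {xs : List A} {x y} → length xs ≤ 1 → x ∈ₗ xs → y ∈ₗ xs → x ≡ y
length≤1⇒≡ {xs = _ ∷ []}    _       (here refl) (here refl) = refl
length≤1⇒≡ {xs = _ ∷ _ ∷ _} (s≤s ()) _          _

unique-≡⇒length≤1 : ∀ {xs : List A} {x} → Unique xs → (∀ {y} → y ∈ₗ xs → y ≡ x) → length xs ≤ 1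
unique-≡⇒length≤1 {xs = []}        _                    _   = z≤n
unique-≡⇒length≤1 {xs = _ ∷ []}    _                    _   = s≤s z≤n
unique-≡⇒length≤1 {xs = _ ∷ _ ∷ _} ((y≢z ∷ _) ∷ _) all≡x =
  ⊥-elim (y≢z (trans (all≡x (here refl)) (sym (all≡x (there (here refl))))))

unique-map-lookup : (f : A → B) (xs : List A) → Unique (map f xs) →
                    ∀ i j → f (lookup xs i) ≡ f (lookup xs j) → i ≡ j
unique-map-lookup f (x ∷ xs) _          zero    zero    _  = refl
unique-map-lookup f (x ∷ xs) (x∉ ∷ _)   zero    (suc j) eq =
  ⊥-elim (All¬⇒¬Any x∉ (subst (_∈ₗ map f xs) (sym eq) (∈-map⁺ f (∈-lookup j))))
unique-map-lookup f (x ∷ xs) (x∉ ∷ _)   (suc i) zero    eq =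
  ⊥-elim (All¬⇒¬Any x∉ (subst (_∈ₗ map f xs) eq (∈-map⁺ f (∈-lookup i))))
unique-map-lookup f (x ∷ xs) (_ ∷ uniq) (suc i) (suc j) eq = cong suc (unique-map-lookup f xs uniq i j eq)

module Count {n p} {P : Pred (Fin n) p} (P? : Decidable P) where

  count : ℕ
  count = length (filter P? (allFin n))

  count-pos : ∀ {i} → P i → 0 < count
  count-pos pi = ∈-length (∈-filter⁺ P? (∈-allFin _) pi)

  count-pos⇒witness : 0 < count → ∃ P
  count-pos⇒witness pos with nonempty⇒∈ pos
  ... | i , i∈ = i , proj₂ (∈-filter⁻ P? {xs = allFin n} i∈)

  count≤1⇒≡ : count ≤ 1 → ∀ {i j} → P i → P j → i ≡ j
  count≤1⇒≡ c≤1 pi pj = length≤1⇒≡ c≤1 (∈-filter⁺ P? (∈-allFin _) pi) (∈-filter⁺ P? (∈-allFin _) pj)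

  ≡⇒count≤1 : ∀ {i} → (∀ {j} → P j → j ≡ i) → count ≤ 1
  ≡⇒count≤1 all≡i = unique-≡⇒length≤1 (filter⁺ P? (allFin⁺ n))
    (λ j∈ → all≡i (proj₂ (∈-filter⁻ P? {xs = allFin n} j∈)))

  count≢1⇒another : count ≢ 1 → ∀ {i} → P i → ∃ λ j → P j × j ≢ i
  count≢1⇒another c≢1 {i} pi with any? (λ j → P? j ×-dec ¬? (j ≟ i))
  ... | yes (j , pj , j≢i) = j , pj , j≢i
  ... | no none = ⊥-elim (c≢1 (ℕₚ.≤-antisym (≡⇒count≤1 only-i) (count-pos pi)))
    where
    only-i : ∀ {j} → P j → j ≡ i
    only-i {j} pj with j ≟ i
    ... | yes j≡i = j≡i
    ... | no j≢i  = ⊥-elim (none (j , pj , j≢i))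

reachIn-start : ∀ {G : Digraph} {P : Node G → Set} {u v} → ReachIn G P u v → P u
reachIn-start (here pu)       = pu
reachIn-start (step _ pu _ _) = pu

module Paths (G : Digraph) where

  infixr 5 _◅◅_

  _◅◅_ : ∀ {u v w} → Reach G u v → Reach G v w → Reach G u w
  here           ◅◅ q = q
  step e refl p  ◅◅ q = step e refl (p ◅◅ q)

  edge : ∀ e → Reach G (src G e) (tgt G e)
  edge e = step e refl here

  steps : ∀ {u v} → Reach G u v → ℕ
  steps here         = zero
  steps (step _ _ p) = suc (steps p)

  steps-◅◅-edge : ∀ {u} e (p : Reach G u (src G e)) → steps (p ◅◅ edge e) ≡ suc (steps p)
  steps-◅◅-edge e here            = refl
  steps-◅◅-edge e (step _ refl p) = cong suc (steps-◅◅-edge e p)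

  last-edge : ∀ {u v} → Reach G u v → u ≢ v → ∃ λ e → tgt G e ≡ v × Reach G u (src G e)
  last-edge here           u≢v = ⊥-elim (u≢v refl)
  last-edge {u} {v} (step e refl p) u≢v with tgt G e ≟ v
  ... | yes refl = e , refl , here
  ... | no  t≢v with last-edge p t≢v
  ...   | f , refl , q = f , refl , step e refl q

  first-on-path : ∀ {P : Node G → Set} → Decidable P → ∀ {u v} → Reach G u v → P v →
                  ∃ λ f → P f × Reach G f v ×
                          (f ≡ u ⊎ ∃ λ e → tgt G e ≡ f × ¬ P (src G e) × Reach G u (src G e))
  first-on-path P? here pv = _ , pv , here , inj₁ refl
  first-on-path P? {u} (step e refl q) pv with P? u
  ... | yes pu = u , pu , step e refl q , inj₁ refl
  ... | no ¬pu with first-on-path P? q pv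
  ...   | f , pf , r , inj₁ refl = f , pf , r , inj₂ (e , refl , ¬pu , here)
  ...   | f , pf , r , inj₂ (e′ , te′ , ¬pe′ , r′) = f , pf , r , inj₂ (e′ , te′ , ¬pe′ , step e refl r′)

  module Acyclic (acyclic : ∀ u → ¬ Reach⁺ G u u) where

    private
      node-at : ∀ {u v} (p : Reach G u v) → Fin (suc (steps p)) → Node G
      node-at {u} here         _       = u
      node-at {u} (step _ _ p) zero    = u
      node-at     (step _ _ p) (suc i) = node-at p i

      node-at-reachable : ∀ {u v} (p : Reach G u v) i → Reach G u (node-at p i)
      node-at-reachable here            zero    = here
      node-at-reachable (step _ _ _)    zero    = here
      node-at-reachable (step e refl p) (suc i) = step e refl (node-at-reachable p i)

      node-at-reachable⁺ : ∀ {u v} (p : Reach G u v) i j → i Fin.< j →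
                           Reach⁺ G (node-at p i) (node-at p j)
      node-at-reachable⁺ (step e refl p) zero    (suc j) _       = step e refl (node-at-reachable p j)
      node-at-reachable⁺ (step e refl p) (suc i) (suc j) (s≤s i<j) = node-at-reachable⁺ p i j i<j

    -- a path visiting nV G + 1 nodes repeats one of them
    steps<nV : ∀ {u v} (p : Reach G u v) → steps p < nV G
    steps<nV p = ℕₚ.≰⇒> λ nV≤steps →
      let i , j , i<j , same = pigeonhole (s≤s nV≤steps) (node-at p)
      in acyclic _ (subst (Reach⁺ G (node-at p i)) (sym same) (node-at-reachable⁺ p i j i<j))

    private
      reach-within? : ∀ k u v → Dec (Σ (Reach G u v) λ p → steps p ≤ k)
      reach-within? k u v with u ≟ v
      ... | yes refl = yes (here , z≤n)
      reach-within? zero u v | no u≢v =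
        no λ { (here , _) → u≢v refl ; (step _ _ _ , ()) }
      reach-within? (suc k) u v | no u≢v with any? (λ e → (src G e ≟ u) ×-dec reach-within? k (tgt G e) v)
      ... | yes (e , refl , p , p≤k) = yes (step e refl p , s≤s p≤k)
      ... | no none = no λ { (here , _) → u≢v refl ; (step e eq p , s≤s p≤k) → none (e , eq , p , p≤k) }

    Reach? : ∀ u v → Dec (Reach G u v)
    Reach? u v with reach-within? (nV G) u v
    ... | yes (p , _) = yes p
    ... | no  none    = no λ p → none (p , ℕₚ.<⇒≤ (steps<nV p))

    reach-source : ∀ v → ∃ λ u → Reach G u v × indeg G u ≡ 0
    reach-source v = extend (nV G) here (ℕₚ.m≤m+n (nV G) 0)
      where
      extend : ∀ k {u} (p : Reach G u v) → nV G ≤ k + steps p → ∃ λ x → Reach G x v × indeg G x ≡ 0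
      extend k {u} p bound with indeg G u ℕ.≟ 0
      ... | yes source = u , p , source
      extend zero    p bound | no _ = ⊥-elim (ℕₚ.<⇒≱ (steps<nV p) bound)
      extend (suc k) p bound | no not-source
        with Count.count-pos⇒witness (λ e → tgt G e ≟ _) (ℕₚ.n≢0⇒n>0 not-source)
      ... | e , refl = extend k (step e refl p) (subst (nV G ≤_) (sym (ℕₚ.+-suc k (steps p))) bound)

    reach-sink : ∀ v → ∃ λ w → Reach G v w × outdeg G w ≡ 0
    reach-sink v = extend (nV G) here (ℕₚ.m≤m+n (nV G) 0)
      where
      extend : ∀ k {w} (p : Reach G v w) → nV G ≤ k + steps p → ∃ λ x → Reach G w x × outdeg G x ≡ 0
      extend k {w} p bound with outdeg G w ℕ.≟ 0
      ... | yes sink = w , here , sink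
      extend zero    p bound | no _ = ⊥-elim (ℕₚ.<⇒≱ (steps<nV p) bound)
      extend (suc k) p bound | no not-sink
        with Count.count-pos⇒witness (λ e → src G e ≟ _) (ℕₚ.n≢0⇒n>0 not-sink)
      ... | e , refl =
        let x , q , sink = extend k (p ◅◅ edge e) (subst (nV G ≤_) longer bound) in x , step e refl q , sink
        where
        longer : suc k + steps p ≡ k + steps (p ◅◅ edge e)
        longer = trans (sym (ℕₚ.+-suc k (steps p))) (cong (k +_) (sym (steps-◅◅-edge e p)))

module Walks (G : Digraph) where

  Step : Set
  Step = Node G × Fin (nE G)

  nodes : List Step → List (Node G)
  nodes = map proj₁

  edges : List Step → List (Fin (nE G))
  edges = map proj₂

  -- a walk from x to y recorded as the list of (node left, edge taken)
  data Walk (Q : Pred (Fin (nE G)) a) : Node G → Node G → List Step → Set a where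
    nil  : ∀ {x} → Walk Q x x []
    cons : ∀ {u w y e L} → Q e → Joins G e u w → Walk Q w y L → Walk Q u y ((u , e) ∷ L)

  module _ {Q : Pred (Fin (nE G)) a} where

    weaken : ∀ {R : Pred (Fin (nE G)) b} → (∀ {e} → Q e → R e) → ∀ {x y L} → Walk Q x y L → Walk R x y L
    weaken f nil          = nil
    weaken f (cons q j w) = cons (f q) j (weaken f w)

    infixr 5 _++ʷ_

    _++ʷ_ : ∀ {x y z L M} → Walk Q x y L → Walk Q y z M → Walk Q x z (L List.++ M)
    nil          ++ʷ w′ = w′
    cons q j w   ++ʷ w′ = cons q j (w ++ʷ w′)

    reverse : ∀ {x y L} → Walk Q x y L → ∃ λ M → Walk Q y x M
    reverse nil = [] , nil
    reverse (cons {u} {w} {e = e} q j rest) =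
      let M , back = reverse rest in M List.++ ((w , e) ∷ []) , back ++ʷ cons q (flip j) nil
      where
      flip : ∀ {e u w} → Joins G e u w → Joins G e w u
      flip (inj₁ p) = inj₂ p
      flip (inj₂ p) = inj₁ p

    from-path : ∀ {u v} (p : Reach G u v) →
                (∀ e → Reach G u (src G e) → Reach G (tgt G e) v → Q e) → ∃ λ L → Walk Q u v L
    from-path here            q = [] , nil
    from-path (step e refl p) q =
      let L , w = from-path p (λ e′ pre post → q e′ (step e refl pre) post)
      in _ , cons (q e here p) (inj₁ (refl , refl)) w

    edge-property : ∀ {x y L e} → Walk Q x y L → e ∈ₗ edges L → Q e
    edge-property (cons q _ _) (here refl) = q
    edge-property (cons _ _ w) (there e∈)  = edge-property w e∈

    private
      starts-at : ∀ {w y L} → Walk Q w y L → w ∈ₗ nodes L ⊎ w ≡ y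
      starts-at nil            = inj₂ refl
      starts-at (cons _ _ _)   = inj₁ (here refl)

      step-target : ∀ {w y L v e} → Walk Q w y L → (v , e) ∈ₗ L →
                    ∃ λ v′ → Joins G e v v′ × (v′ ∈ₗ nodes L ⊎ v′ ≡ y)
      step-target (cons {w = w} _ j rest) (here refl) with starts-at rest
      ... | inj₁ w∈ = w , j , inj₁ (there w∈)
      ... | inj₂ w≡ = w , j , inj₂ w≡
      step-target (cons _ _ rest) (there s∈) with step-target rest s∈
      ... | v′ , j , inj₁ v′∈ = v′ , j , inj₁ (there v′∈)
      ... | v′ , j , inj₂ v′≡ = v′ , j , inj₂ v′≡

      joins-same-edge : ∀ {e u w v v′} → Joins G e u w → Joins G e v v′ → v ≡ u ⊎ (v ≡ w × v′ ≡ u)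
      joins-same-edge (inj₁ (refl , refl)) (inj₁ (refl , refl)) = inj₁ refl
      joins-same-edge (inj₁ (refl , refl)) (inj₂ (refl , refl)) = inj₂ (refl , refl)
      joins-same-edge (inj₂ (refl , refl)) (inj₁ (refl , refl)) = inj₂ (refl , refl)
      joins-same-edge (inj₂ (refl , refl)) (inj₂ (refl , refl)) = inj₁ refl

    Simple : Node G → List Step → Set
    Simple y L = Unique (nodes L) × Unique (edges L) × y ∉ₗ nodes L

    private
      suffix-from : ∀ {w y L u} → Walk Q w y L → Simple y L → u ∈ₗ nodes L →
                    ∃ λ M → Walk Q u y M × Simple y M
      suffix-from (cons q j w) s (here refl) = _ , cons q j w , s
      suffix-from (cons _ _ w) (_ ∷ n , _ ∷ e , y∉) (there u∈) = suffix-from w (n , e , λ y∈ → y∉ (there y∈)) u∈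

    erase-loops : ∀ {x y L} → Walk Q x y L → ∃ λ M → Walk Q x y M × Simple y M
    erase-loops nil = [] , nil , [] , [] , λ ()
    erase-loops {y = y} (cons {u} {w} {e = e} q j rest) with erase-loops rest
    ... | M , rest′ , simple@(uniq-nodes , uniq-edges , y∉) with u ≟ y
    ...   | yes refl = [] , nil , [] , [] , λ ()
    ...   | no u≢y with Any.any? (u ≟_) (nodes M)
    ...     | yes u∈ = suffix-from rest′ simple u∈
    ...     | no  u∉ = (u , e) ∷ M , cons q j rest′
                     , ¬Any⇒All¬ _ u∉ ∷ uniq-nodes , ¬Any⇒All¬ _ e∉ ∷ uniq-edges , y∉′
      where
      e∉ : e ∉ₗ edges M
      e∉ e∈ with ∈-map⁻ proj₂ e∈
      ... | (v , _) , s∈ , refl with step-target rest′ s∈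
      ...   | v′ , j′ , v′-later with joins-same-edge j j′
      ...     | inj₁ refl = u∉ (∈-map⁺ proj₁ s∈)
      ...     | inj₂ (refl , refl) with v′-later
      ...       | inj₁ u∈ = u∉ u∈
      ...       | inj₂ u≡y = u≢y u≡y
      y∉′ : y ∉ₗ nodes ((u , e) ∷ M)
      y∉′ (here y≡u) = u≢y (sym y≡u)
      y∉′ (there y∈) = y∉ y∈

    private
      -- the node reached by step i of the walk L ending at y
      reached : (L : List Step) → Node G → Fin (length L) → Node G
      reached (_ ∷ [])     y zero    = y
      reached (_ ∷ s ∷ _)  y zero    = proj₁ s
      reached (_ ∷ s ∷ L)  y (suc i) = reached (s ∷ L) y i

      step-joins : ∀ {x y} L → Walk Q x y L → ∀ i →
                   Joins G (proj₂ (lookup L i)) (proj₁ (lookup L i)) (reached L y i)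
      step-joins (_ ∷ [])    (cons _ j nil)          zero    = j
      step-joins (_ ∷ _ ∷ _) (cons _ j (cons _ _ _)) zero    = j
      step-joins (_ ∷ _ ∷ _) (cons _ _ rest)         (suc i) = step-joins _ rest i

      -- the list of visited nodes with its head replaced by y
      rotated : (L : List Step) → Node G → Fin (length L) → Node G
      rotated (_ ∷ _) y zero    = y
      rotated (_ ∷ L) y (suc j) = proj₁ (lookup L j)

      reached-next : ∀ s L y (i : Fin (suc (length L))) → reached (s ∷ L) y i ≡ rotated (s ∷ L) y (next i)
      reached-next s []      y zero    = refl
      reached-next s (_ ∷ _) y zero    = refl
      reached-next s (t ∷ L) y (suc i) with next {length L} i | reached-next t L y i
      ... | zero  | eq = eq
      ... | suc _ | eq = eq

    closing-cycle : ∀ {x y L} → Walk Q x y L → Simple y L → ∀ e → Q e → Joins G e y x → e ∉ₗ edges L →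
                    Σ (UCycle G) λ c → vs c zero ≡ y × (∀ i → Q (es c i))
    closing-cycle {y = y} {L} w (uniq-nodes , uniq-edges , y∉) e q j e∉ =
      record { len    = length L
             ; vs     = node
             ; es     = edge
             ; vs-inj = unique-map-lookup proj₁ C (¬Any⇒All¬ _ y∉ ∷ uniq-nodes)
             ; es-inj = unique-map-lookup proj₂ C (¬Any⇒All¬ _ e∉ ∷ uniq-edges)
             ; joins  = λ i → subst (Joins G (edge i) (node i)) (joins-next i) (step-joins C closed i) }
      , refl , edge-q closed
      where
      C : List Step
      C = (y , e) ∷ L
      node : Fin (suc (length L)) → Node G
      node i = proj₁ (lookup C i)
      edge : Fin (suc (length L)) → Fin (nE G)
      edge i = proj₂ (lookup C i)
      closed : Walk Q y y C
      closed = cons q j w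
      joins-next : ∀ i → reached C y i ≡ node (next i)
      joins-next i with next i | reached-next (y , e) L y i
      ... | zero  | eq = eq
      ... | suc _ | eq = eq
      edge-q : ∀ {u} {M} → Walk Q u y M → ∀ i → Q (proj₂ (lookup M i))
      edge-q (cons q _ _)    zero    = q
      edge-q (cons _ _ rest) (suc i) = edge-q rest i

  walk-cycle : ∀ {Q : Pred (Fin (nE G)) a} {x y L} e → Walk (λ f → Q f × f ≢ e) x y L → Q e → Joins G e y x →
               Σ (UCycle G) λ c → vs c zero ≡ y × (∀ i → Q (es c i))
  walk-cycle e w q j =
    let M , w′ , simple = erase-loops w
    in closing-cycle (weaken proj₁ w′) simple e q j (λ e∈ → proj₂ (edge-property w′ e∈) refl)

module Network (G : Digraph) (net : IsNetwork G) where
  open Paths G public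
  open Acyclic (proj₁ net) public

  acyclic : ∀ u → ¬ Reach⁺ G u u
  acyclic = proj₁ net

  root : Node G
  root = proj₁ (proj₂ net)

  root-is-root : IsRoot G root
  root-is-root = proj₁ (proj₂ (proj₂ net))

  root-unique : ∀ v → IsRoot G v → v ≡ root
  root-unique = proj₂ (proj₂ (proj₂ net))

  root-reach : ∀ v → Reach G root v
  root-reach v with reach-source v
  ... | u , p , source with root-unique u source
  ...   | refl = p

  not-root⇒parent : ∀ {v} → v ≢ root → ∃ λ e → tgt G e ≡ v
  not-root⇒parent v≢root with last-edge (root-reach _) (λ root≡v → v≢root (sym root≡v))
  ... | e , te , _ = e , te

module Tree (G : Digraph) (tree : IsTree G) where
  open Network G (proj₁ tree) public
  open Walks G

  -- two parents of a node, with the paths from the root to them, would close a cycle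
  parent-unique : ∀ e₁ e₂ → tgt G e₁ ≡ tgt G e₂ → e₁ ≡ e₂
  parent-unique e₁ e₂ same with e₁ ≟ e₂
  ... | yes e₁≡e₂ = e₁≡e₂
  ... | no  e₁≢e₂ = ⊥-elim (proj₂ tree (proj₁ (walk-cycle e₁ around tt (inj₁ (refl , refl)))))
    where
    Avoid : Pred (Fin (nE G)) _
    Avoid f = ⊤ × f ≢ e₁
    up : ∃ λ L → Walk Avoid (src G e₂) root L
    up = reverse (proj₂ (from-path (root-reach (src G e₂))
           λ f _ back → tt , λ { refl → acyclic _ (step e₂ refl (subst (λ x → Reach G x (src G e₂)) same back)) }))
    down : ∃ λ L → Walk Avoid root (src G e₁) L
    down = from-path (root-reach (src G e₁)) λ f _ back → tt , λ { refl → acyclic _ (step e₁ refl back) }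
    around : Walk Avoid (tgt G e₁) (src G e₁) _
    around = cons (tt , λ e₂≡e₁ → e₁≢e₂ (sym e₂≡e₁)) (inj₂ (refl , sym same)) (proj₂ up ++ʷ proj₂ down)

  indeg≡1 : ∀ {v} e → tgt G e ≡ v → indeg G v ≡ 1
  indeg≡1 {v} e te = ℕₚ.≤-antisym
    (Count.≡⇒count≤1 (λ f → tgt G f ≟ v) (λ {f} tf → parent-unique f e (trans tf (sym te))))
    (Count.count-pos (λ f → tgt G f ≟ v) te)

  parent-on-path : ∀ {u v} → Reach G u v → u ≢ v → ∀ e → tgt G e ≡ v → Reach G u (src G e)
  parent-on-path p u≢v e te with last-edge p u≢v
  ... | f , tf , q with parent-unique f e (trans tf (sym te))
  ...   | refl = q

  ancestors-comparable : ∀ {u w v} → Reach G u v → Reach G w v → Reach G u w ⊎ Reach G w u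
  ancestors-comparable here q = inj₂ q
  ancestors-comparable {w = w} (step e refl p) q with ancestors-comparable p q
  ... | inj₁ r = inj₁ (step e refl r)
  ... | inj₂ r with w ≟ tgt G e
  ...   | yes refl = inj₁ (edge e)
  ...   | no  w≢t  = inj₂ (parent-on-path r w≢t e refl)

module SupportEdges (G : Digraph) (sel : Fin (nE G) → Bool) where

  S : Digraph
  S = SupportTree G sel

  Support Transfer : Fin (nE G) → Set
  Support e  = True (sel e)
  Transfer e = ¬ Support e

  private
    kept : List (Fin (nE G))
    kept = filter (λ e → T? (sel e)) (allFin (nE G))

  embed : Fin (nE S) → Fin (nE G)
  embed = lookup kept

  embed-support : ∀ i → Support (embed i)
  embed-support i = proj₂ (∈-filter⁻ (λ e → T? (sel e)) {xs = allFin (nE G)} (∈-lookup i))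

  support-edge : ∀ e → Support e → Σ (Fin (nE S)) λ i → embed i ≡ e
  support-edge e sel-e = Any.index e∈ , sym (lookup-index e∈)
    where e∈ = ∈-filter⁺ (λ e → T? (sel e)) (∈-allFin e) sel-e

  support-cycle : (c : UCycle G) → (∀ i → Support (es c i)) → UCycle S
  support-cycle c support = record
    { len    = len c
    ; vs     = vs c
    ; es     = edge-of
    ; vs-inj = vs-inj c
    ; es-inj = λ i j same → es-inj c i j
                 (trans (sym (proj₂ (support-edge _ (support i))))
                        (trans (cong embed same) (proj₂ (support-edge _ (support j)))))
    ; joins  = λ i → joins-of i (joins c i) }
    where
    edge-of : Fin (suc (len c)) → Fin (nE S)
    edge-of i = proj₁ (support-edge (es c i) (support i))
    joins-of : ∀ i {x y} → Joins G (es c i) x y → Joins S (edge-of i) x y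
    joins-of i j rewrite proj₂ (support-edge (es c i) (support i)) = j

module GalledLGT (G : Digraph) (sel : Fin (nE G) → Bool) (lgt : IsLGT G sel) (galled : IsGalledTree G) where
  open SupportEdges G sel public
  open Walks G

  support-tree : IsTree S
  support-tree = proj₁ (proj₂ lgt)

  module S = Tree S support-tree

  data Between (X : Pred (Node G) a) (Y : Pred (Node G) b) (t : Fin (nE G)) : Set (a ⊔ b) where
    forward  : X (src G t) → Y (tgt G t) → Between X Y t
    backward : X (tgt G t) → Y (src G t) → Between X Y t

  between-∩ : ∀ {X₁ Y₁ X₂ Y₂ : Pred (Node G) a} {t} → (∀ {v} → Y₁ v → ¬ X₂ v) → (∀ {v} → Y₂ v → ¬ X₁ v) →
              Between X₁ Y₁ t → Between X₂ Y₂ t → Between (X₁ ∩ X₂) (Y₁ ∩ Y₂) t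
  between-∩ _     _     (forward x₁ y₁)  (forward x₂ y₂)  = forward (x₁ , x₂) (y₁ , y₂)
  between-∩ _     Y₂∌X₁ (forward x₁ _)   (backward _ y₂)  = ⊥-elim (Y₂∌X₁ y₂ x₁)
  between-∩ Y₁∌X₂ _     (backward _ y₁)  (forward x₂ _)   = ⊥-elim (Y₁∌X₂ y₁ x₂)
  between-∩ _     _     (backward x₁ y₁) (backward x₂ y₂) = backward (x₁ , x₂) (y₁ , y₂)

  module Boundary (z : Node G) (iz : Fin (nE S)) (tz : tgt S iz ≡ z) where

    Below : Node G → Set
    Below = Reach S z

    Exits Enters Crosses : Fin (nE G) → Set
    Exits  t = Below (src G t) × ¬ Below (tgt G t)
    Enters t = ¬ Below (src G t) × Below (tgt G t)
    Crosses t = Exits t ⊎ Enters t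

    private
      p : Node G
      p = src S iz

      parent-not-below : ¬ Below p
      parent-not-below z⇝p = S.acyclic p (step iz refl (subst (λ x → Reach S x p) (sym tz) z⇝p))

    -- the support paths z ⇝ t ⇝ root ⇝ p together with iz close a cycle through p using t
    crossing-cycle : ∀ t → Transfer t → Crosses t →
                     Σ (UCycle G) λ c → vs c zero ≡ p × (∀ i → Support (es c i) ⊎ es c i ≡ t) × UsesEdge c t
    crossing-cycle t transfer crosses with walk-cycle ez (proj₂ (around crosses)) (inj₁ (embed-support iz)) (inj₁ (refl , tz))
      where
      ez : Fin (nE G)
      ez = embed iz
      Allowed : Pred (Fin (nE G)) _
      Allowed f = (Support f ⊎ f ≡ t) × f ≢ ez
      lands-in-z : ∀ i → embed i ≡ ez → src S i ≡ p × tgt S i ≡ z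
      lands-in-z i same = cong (src G) same , trans (cong (tgt G) same) tz
      support-walk : ∀ {u v} (q : Reach S u v) →
                     (∀ i → Reach S u (src S i) → Reach S (tgt S i) v → embed i ≢ ez) → ∃ λ L → Walk Allowed u v L
      support-walk here            _     = [] , nil
      support-walk (step i refl q) avoid =
        let _ , w = support-walk q (λ j pre post → avoid j (step i refl pre) post)
        in _ , cons (inj₁ (embed-support i) , avoid i here q) (inj₁ (refl , refl)) w
      down : ∀ {a} → Below a → ∃ λ L → Walk Allowed z a L
      down z⇝a = support-walk z⇝a λ i pre _ same →
        parent-not-below (subst Below (proj₁ (lands-in-z i same)) pre)
      up : ∀ {b} → ¬ Below b → ∃ λ L → Walk Allowed b p L
      up {b} b∉ =
        let _ , to-root = reverse (proj₂ (support-walk (S.root-reach b) λ i _ post same →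
                                    b∉ (subst (λ x → Reach S x b) (proj₂ (lands-in-z i same)) post)))
            _ , to-p    = support-walk (S.root-reach p) λ i _ post same →
                            parent-not-below (subst (λ x → Reach S x p) (proj₂ (lands-in-z i same)) post)
        in _ , to-root ++ʷ to-p
      t≢ez : t ≢ ez
      t≢ez refl = transfer (embed-support iz)
      around : Crosses t → ∃ λ L → Walk Allowed z p L
      around (inj₁ (a∈ , b∉)) = _ , proj₂ (down a∈) ++ʷ cons (inj₂ refl , t≢ez) (inj₁ (refl , refl)) (proj₂ (up b∉))
      around (inj₂ (a∉ , b∈)) = _ , proj₂ (down b∈) ++ʷ cons (inj₂ refl , t≢ez) (inj₂ (refl , refl)) (proj₂ (up a∉))
    ... | c , at-p , allowed with any? (λ i → ¬? (T? (sel (es c i))))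
    ...   | yes (i , not-support) = c , at-p , allowed , i , is-t (allowed i)
      where
      is-t : Support (es c i) ⊎ es c i ≡ t → es c i ≡ t
      is-t (inj₁ support) = ⊥-elim (not-support support)
      is-t (inj₂ eq)      = eq
    ...   | no none = ⊥-elim (proj₂ support-tree (support-cycle c support))
      where
      support : ∀ i → Support (es c i)
      support i with allowed i
      ... | inj₁ s  = s
      ... | inj₂ eq = ⊥-elim (none (i , subst Transfer (sym eq) transfer))

    -- two crossing transfer edges would give two distinct cycles sharing p
    crossing-unique : ∀ {t₁ t₂} → Transfer t₁ → Transfer t₂ → Crosses t₁ → Crosses t₂ → t₁ ≡ t₂
    crossing-unique {t₁} {t₂} transfer₁ transfer₂ crosses₁ crosses₂ with t₁ ≟ t₂
    ... | yes t₁≡t₂ = t₁≡t₂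
    ... | no  t₁≢t₂ with crossing-cycle t₁ transfer₁ crosses₁ | crossing-cycle t₂ transfer₂ crosses₂
    ...   | c₁ , at-p₁ , _ , uses₁ | c₂ , at-p₂ , allowed₂ , _ =
      ⊥-elim (proj₂ galled c₁ c₂ (inj₁ (t₁ , uses₁ , unused)) (p , (zero , at-p₁) , (zero , at-p₂)))
      where
      unused : ¬ UsesEdge c₂ t₁
      unused (i , refl) with allowed₂ i
      ... | inj₁ support = transfer₁ support
      ... | inj₂ eq      = t₁≢t₂ eq

    between⇒crosses : ∀ {X : Pred (Node G) a} {Y : Pred (Node G) b} {t} →
                      (∀ {v} → X v → Below v) → (∀ {v} → Y v → ¬ Below v) → Between X Y t → Crosses t
    between⇒crosses X⊆ Y∌ (forward x y)  = inj₁ (X⊆ x , Y∌ y)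
    between⇒crosses X⊆ Y∌ (backward x y) = inj₂ (Y∌ y , X⊆ x)

    Below? : ∀ v → Dec (Below v)
    Below? = S.Reach? z

    leave : ∀ {P : Node G → Set} {u v} → ReachIn G P u v → Below u → ¬ Below v →
            ∃ λ t → Transfer t × Exits t × ReachIn G P (tgt G t) v
    leave (here _)            u∈ v∉ = ⊥-elim (v∉ u∈)
    leave (step e _ refl q) u∈ v∉ with Below? (tgt G e)
    ... | yes t∈ = leave q t∈ v∉
    ... | no  t∉ with T? (sel e)
    ...   | no  transfer = e , transfer , (u∈ , t∉) , q
    ...   | yes support with support-edge e support
    ...     | i , refl = ⊥-elim (t∉ (u∈ S.◅◅ S.edge i))

    -- entering through a support edge would mean passing through p
    enter : ∀ {P : Node G → Set} {u v} → ¬ P p → ReachIn G P u v → ¬ Below u → Below v →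
            ∃ λ t → Transfer t × Enters t × P (src G t) × ReachIn G P (tgt G t) v
    enter ¬Pp (here _)          u∉ v∈ = ⊥-elim (u∉ v∈)
    enter ¬Pp (step e Pu refl q) u∉ v∈ with Below? (tgt G e)
    ... | no  t∉ = enter ¬Pp q t∉ v∈
    ... | yes t∈ with T? (sel e)
    ...   | no  transfer = e , transfer , (u∉ , t∈) , Pu , q
    ...   | yes support with support-edge e support
    ...     | i , refl with z ≟ tgt S i
    ...       | no  z≢t = ⊥-elim (u∉ (S.parent-on-path t∈ z≢t i refl))
    ...       | yes z≡t with S.parent-unique i iz (trans (sym z≡t) (sym tz))
    ...         | refl = ⊥-elim (¬Pp Pu)

    only-exit : ∀ {P : Node G → Set} {t u v} → Transfer t → Crosses t →
                ReachIn G P u v → Below u → ¬ Below v → Exits t × ReachIn G P (tgt G t) v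
    only-exit transfer crosses path u∈ v∉ with leave path u∈ v∉
    ... | t′ , transfer′ , exits′ , rest with crossing-unique transfer′ transfer (inj₁ exits′) crosses
    ...   | refl = exits′ , rest

    only-entry : ∀ {P : Node G → Set} {t u v} → ¬ P p → Transfer t → Crosses t →
                 ReachIn G P u v → ¬ Below u → Below v → Enters t × ReachIn G P (tgt G t) v
    only-entry ¬Pp transfer crosses path u∉ v∈ with enter ¬Pp path u∉ v∈
    ... | t′ , transfer′ , enters′ , _ , rest with crossing-unique transfer′ transfer (inj₂ enters′) crosses
    ...   | refl = enters′ , rest

    no-return : ∀ {P : Node G → Set} {t v} → Transfer t → Enters t → ReachIn G P (tgt G t) v → ¬ Below v → ⊥
    no-return transfer enters@(src∉ , tgt∈) path v∉ = src∉ (proj₁ (proj₁ (only-exit transfer (inj₂ enters) path tgt∈ v∉)))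

module Suppression {T′ : Digraph} {s : ℕ} {labT : Fin s → Node T′} {S : Digraph} {labS : Fin s → Node S}
                   (sup : IsSuppressionOf T′ s labT S labS) where

  φ : Node T′ → Node S
  φ = proj₁ sup

  private
    φ-injective : ∀ x y → φ x ≡ φ y → x ≡ y
    φ-injective = proj₁ (proj₂ sup)

    φ-edge : ∀ x y → (Edge T′ x y → SuppressedEdge S (φ x) (φ y)) × (SuppressedEdge S (φ x) (φ y) → Edge T′ x y)
    φ-edge = proj₂ (proj₂ (proj₂ (proj₂ (proj₂ sup))))

    φ-not-subdivision : ∀ x → ¬ IsSubdiv S (φ x)
    φ-not-subdivision = proj₁ (proj₂ (proj₂ sup))

  φ-onto : ∀ v → ¬ IsSubdiv S v → ∃ λ x → φ x ≡ v
  φ-onto = proj₁ (proj₂ (proj₂ (proj₂ sup)))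

  φ-label : ∀ i → φ (labT i) ≡ labS i
  φ-label = proj₁ (proj₂ (proj₂ (proj₂ (proj₂ sup))))

  IsSubdiv? : ∀ v → Dec (IsSubdiv S v)
  IsSubdiv? v = (indeg S v ℕ.≟ 1) ×-dec (outdeg S v ℕ.≟ 1)

  private
    module S = Paths S

    suppressed⇒reach : ∀ {u v} → SuppressedEdge S u v → Reach S u v
    suppressed⇒reach (direct (i , refl , refl))  = S.edge i
    suppressed⇒reach (via (i , refl , refl) _ r) = step i refl (suppressed⇒reach r)

  reach-φ : ∀ {x y} → Reach T′ x y → Reach S (φ x) (φ y)
  reach-φ here                = here
  reach-φ {x} (step e refl p) = suppressed⇒reach (proj₁ (φ-edge x (tgt T′ e)) (e , refl , refl)) S.◅◅ reach-φ p

  private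
    -- Walking down a path of S we remember the last kept node x: the subdivision
    -- nodes passed since then lie on a suppressed edge leaving φ x.
    Pending : Node T′ → Node S → Set
    Pending x v = ∀ {w} → SuppressedEdge S v w → SuppressedEdge S (φ x) w

    Hanging : Node T′ → Node S → Set
    Hanging x v = v ≡ φ x ⊎ (IsSubdiv S v × Pending x v)

    pending : ∀ {x v} → Hanging x v → Pending x v
    pending (inj₁ refl)          r = r
    pending (inj₂ (_ , prolong)) r = prolong r

    reach-φ⁻¹′ : ∀ {v y} → Reach S v (φ y) → ∀ x → Hanging x v → Reach T′ x y
    reach-φ⁻¹′ {y = y} here x (inj₁ φy≡φx) with φ-injective x y (sym φy≡φx)
    ... | refl = here
    reach-φ⁻¹′ {y = y} here x (inj₂ (subdiv , _)) = ⊥-elim (φ-not-subdivision y subdiv)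
    reach-φ⁻¹′ (step i refl p) x hanging with IsSubdiv? (tgt S i)
    ... | yes subdiv = reach-φ⁻¹′ p x (inj₂ (subdiv , λ r → pending hanging (via (i , refl , refl) subdiv r)))
    ... | no  kept with φ-onto _ kept
    ...   | x′ , φx′≡t with proj₂ (φ-edge x x′) (subst (SuppressedEdge S (φ x)) (sym φx′≡t)
                                                       (pending hanging (direct (i , refl , refl))))
    ...     | e , refl , refl = step e refl (reach-φ⁻¹′ p x′ (inj₁ (sym φx′≡t)))

  reach-φ⁻¹ : ∀ {x y} → Reach S (φ x) (φ y) → Reach T′ x y
  reach-φ⁻¹ {x} p = reach-φ⁻¹′ p x (inj₁ refl)

module Completion (T : Digraph) (s : ℕ) (labT : Fin s → Node T)
                  (tree : IsTree T) (leaves : HasLeafSet T s labT) (no-subdivision : ∀ v → ¬ IsSubdiv T v)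
                  (G : Digraph) (sel : Fin (nE G) → Bool) (lab : Fin s → Node G)
                  (lgt : IsLGT G sel) (galled : IsGalledTree G)
                  (sup : IsSuppressionOf T s labT (SupportTree G sel) lab) where

  open GalledLGT G sel lgt galled
  open Suppression sup
  module T = Tree T tree

  lab≡φ : ∀ i → lab i ≡ φ (labT i)
  lab≡φ i = sym (φ-label i)

  Good : Character s → Node G → Set
  Good C v = ¬ InF G sel lab C v

  Good? : ∀ C v → Dec (Good C v)
  Good? C v = ¬? (any? λ i → S.Reach? v (lab i) ×-dec ¬? (i ∈? C))

  good-below : ∀ {C u v} → Good C u → Reach S u v → Good C v
  good-below good u⇝v (i , v⇝i , i∉C) = good (i , u⇝v S.◅◅ v⇝i , i∉C)

  LeavesIn : Character s → Node T → Set
  LeavesIn C x = LeavesWithin T labT x C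

  LeavesIn? : ∀ C x → Dec (LeavesIn C x)
  LeavesIn? C x = all? λ i → T.Reach? x (labT i) →-dec (i ∈? C)

  leaves-in⇒good : ∀ {C x} → LeavesIn C x → Good C (φ x)
  leaves-in⇒good within (i , φx⇝i , i∉C) = i∉C (within i (reach-φ⁻¹ (subst (Reach S _) (lab≡φ i) φx⇝i)))

  good⇒leaves-in : ∀ {C x} → Good C (φ x) → LeavesIn C x
  good⇒leaves-in {C} good i x⇝i with i ∈? C
  ... | yes i∈C = i∈C
  ... | no  i∉C = ⊥-elim (good (i , subst (Reach S _) (φ-label i) (reach-φ x⇝i) , i∉C))

  leaf-end : ∀ {i y} → Reach T (labT i) y → y ≡ labT i
  leaf-end here               = refl
  leaf-end {i} (step e i≡s _) =
    ⊥-elim (ℕₚ.<⇒≢ (Count.count-pos (λ f → src T f ≟ labT i) i≡s) (sym (proj₂ (proj₁ leaves i))))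

  leaf-in : ∀ {C i} → i ∈ C → LeavesIn C (labT i)
  leaf-in {C} i∈C j i⇝j = subst (_∈ C) (proj₁ (proj₂ leaves) _ _ (sym (leaf-end i⇝j))) i∈C

  sink-is-leaf : ∀ {w} → (∃ λ e → tgt T e ≡ w) → outdeg T w ≡ 0 → ∃ λ i → labT i ≡ w
  sink-is-leaf {w} (e , te) sink = proj₂ (proj₂ leaves) w (T.indeg≡1 e te , sink)

  leaf-below : ∀ {x} → (∃ λ e → tgt T e ≡ x) → ∃ λ i → Reach T x (labT i)
  leaf-below {x} x-parent with T.reach-sink x
  ... | w , x⇝w , sink with sink-is-leaf (w-parent x-parent) sink
    where
    w-parent : (∃ λ e → tgt T e ≡ x) → ∃ λ e → tgt T e ≡ w
    w-parent x-parent with x ≟ w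
    ... | yes refl = x-parent
    ... | no  x≢w  = let f , tf , _ = T.last-edge x⇝w x≢w in f , tf
  ...   | i , refl = i , x⇝w

  -- d is not a subdivision node, so besides the child towards c it has another one
  leaf-off-path : ∀ {c d} → d ≢ c → Reach T d c → (∃ λ e → tgt T e ≡ d) →
                  ∃ λ i → Reach T d (labT i) × ¬ Reach T c (labT i)
  leaf-off-path d≢c here _ = ⊥-elim (d≢c refl)
  leaf-off-path {c} _ (step e₁ refl t₁⇝c) (e₀ , te₀)
    with Count.count≢1⇒another (λ f → src T f ≟ src T e₁) (λ one → no-subdivision _ (T.indeg≡1 e₀ te₀ , one)) refl
  ... | e₂ , s₂ , e₂≢e₁ with leaf-below (e₂ , refl)
  ...   | i , t₂⇝i = i , step e₂ s₂ t₂⇝i , off-path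
    where
    siblings-incomparable : ∀ {f g} → src T f ≡ src T g → f ≢ g → ¬ Reach T (tgt T f) (tgt T g)
    siblings-incomparable {f} {g} sf≡sg f≢g tf⇝tg with tgt T f ≟ tgt T g
    ... | yes same   = f≢g (T.parent-unique f g same)
    ... | no  differ = T.acyclic _ (step f sf≡sg (T.parent-on-path tf⇝tg differ g refl))
    off-path : ¬ Reach T c (labT i)
    off-path c⇝i with T.ancestors-comparable (t₁⇝c T.◅◅ c⇝i) t₂⇝i
    ... | inj₁ t₁⇝t₂ = siblings-incomparable (sym s₂) (λ e₁≡e₂ → e₂≢e₁ (sym e₁≡e₂)) t₁⇝t₂
    ... | inj₂ t₂⇝t₁ = siblings-incomparable s₂ e₂≢e₁ t₂⇝t₁

  incomparable⇒parent : ∀ {c d} → ¬ Reach T c d → ∃ λ e → tgt T e ≡ c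
  incomparable⇒parent {c} {d} c⇏d = T.not-root⇒parent λ { refl → c⇏d (T.root-reach d) }

  FA-parent : ∀ {C c} → IsFA T labT C c → ∀ e → tgt T e ≡ c → ¬ LeavesIn C (src T e)
  FA-parent (_ , inj₁ root) e te = ⊥-elim (ℕₚ.<⇒≢ (Count.count-pos (λ f → tgt T f ≟ _) te) (sym root))
  FA-parent (_ , inj₂ (_ , (f , refl , tf) , outside)) e te with T.parent-unique f e (trans tf (sym te))
  ... | refl = outside

  FA-incomparable : ∀ {C c₁ c₂} → IsFA T labT C c₁ → IsFA T labT C c₂ → c₁ ≢ c₂ → ¬ Reach T c₁ c₂
  FA-incomparable fa₁ fa₂ c₁≢c₂ c₁⇝c₂ with T.last-edge c₁⇝c₂ c₁≢c₂
  ... | e , te , c₁⇝p = FA-parent fa₂ e te (λ i p⇝i → proj₁ fa₁ i (c₁⇝p T.◅◅ p⇝i))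

  FA-above : ∀ {C x} → LeavesIn C x → ∃ λ f → IsFA T labT C f × Reach T f x
  FA-above {C} {x} within with T.first-on-path (LeavesIn? C) (T.root-reach x) within
  ... | f , f-in , f⇝x , inj₁ refl                   = f , (f-in , inj₁ T.root-is-root) , f⇝x
  ... | f , f-in , f⇝x , inj₂ (e , te , outside , _) = f , (f-in , inj₂ (src T e , (e , refl , te) , outside)) , f⇝x

  -- z is the highest good node above φ c; chain says that only subdivision nodes lie between them
  record Top (C : Character s) (c : Node T) : Set where
    field
      z          : Node G
      iz         : Fin (nE S)
      iz-into    : tgt S iz ≡ z
      parent-bad : ¬ Good C (src S iz)
      z-above    : Reach S z (φ c)
      chain      : ∀ {v} → Reach S z v → Reach S v (φ c) ⊎ Reach S (φ c) v

  open Top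

  top : ∀ {C c} → IsFA T labT C c → (∃ λ e → tgt T e ≡ c) → Top C c
  top {C} {c} fa (e , te) with S.first-on-path (Good? C) (S.root-reach (φ c)) (leaves-in⇒good (proj₁ fa))
  ... | _ , root-good , _ , inj₁ refl =
    ⊥-elim (FA-parent fa e te (good⇒leaves-in (good-below root-good (S.root-reach _))))
  ... | f , f-good , f⇝c , inj₂ (i , ti , parent-bad , _) =
    record { z = f ; iz = i ; iz-into = ti ; parent-bad = parent-bad ; z-above = f⇝c ; chain = chain-below f⇝c here }
    where
    only-c : ∀ x → Reach S f (φ x) → Reach S (φ x) (φ c) → x ≡ c
    only-c x f⇝x x⇝c with x ≟ c
    ... | yes x≡c = x≡c
    ... | no  x≢c = ⊥-elim (FA-parent fa e te (good⇒leaves-in (good-below f-good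
                      (f⇝x S.◅◅ reach-φ (T.parent-on-path (reach-φ⁻¹ x⇝c) x≢c e te)))))
    chain-below : ∀ {w} → Reach S w (φ c) → Reach S f w → ∀ {v} → Reach S w v → Reach S v (φ c) ⊎ Reach S (φ c) v
    chain-below here            _   w⇝v  = inj₂ w⇝v
    chain-below (step i si w⇝c) _   here = inj₁ (step i si w⇝c)
    chain-below {w} (step i si w⇝c) f⇝w (step j sj w⇝v) with IsSubdiv? w
    ... | no kept with φ-onto w kept
    ...   | x , refl with only-c x f⇝w (step i si w⇝c)
    ...     | refl = inj₂ (step j sj w⇝v)
    chain-below {w} (step i si w⇝c) f⇝w (step j sj w⇝v) | yes (_ , one)
      with Count.count≤1⇒≡ (λ k → src S k ≟ w) (ℕₚ.≤-reflexive one) sj si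
    ... | refl = chain-below w⇝c (f⇝w S.◅◅ step i si here) w⇝v

  tops-overlap⇒comparable : ∀ {C C′ c c′} (X : Top C c) (Y : Top C′ c′) {v} →
                            Reach S (z X) v → Reach S (z Y) v → Comparable T c c′
  tops-overlap⇒comparable X Y zX⇝v zY⇝v with S.ancestors-comparable zX⇝v zY⇝v
  ... | inj₁ zX⇝zY with chain X (zX⇝zY S.◅◅ z-above Y)
  ...   | inj₁ c′⇝c = inj₁ (reach-φ⁻¹ c′⇝c)
  ...   | inj₂ c⇝c′ = inj₂ (reach-φ⁻¹ c⇝c′)
  tops-overlap⇒comparable X Y zX⇝v zY⇝v | inj₂ zY⇝zX with chain Y (zY⇝zX S.◅◅ z-above X)
  ...   | inj₁ c⇝c′ = inj₂ (reach-φ⁻¹ c⇝c′)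
  ...   | inj₂ c′⇝c = inj₁ (reach-φ⁻¹ c′⇝c)

  top-leaf : ∀ {C c} (X : Top C c) {i} → Reach S (z X) (lab i) → Reach T c (labT i)
  top-leaf X {i} z⇝i with chain X (subst (Reach S (z X)) (lab≡φ i) z⇝i)
  ... | inj₁ i⇝c = subst (λ x → Reach T x (labT i)) (sym (leaf-end (reach-φ⁻¹ i⇝c))) here
  ... | inj₂ c⇝i = reach-φ⁻¹ c⇝i

  good-above-top : ∀ {C c} (X : Top C c) {v} → Good C v → Reach S v (z X) → v ≡ z X
  good-above-top X {v} good v⇝z with v ≟ z X
  ... | yes v≡z = v≡z
  ... | no  v≢z = ⊥-elim (parent-bad X (good-below good (S.parent-on-path v⇝z v≢z (iz X) (iz-into X))))

  module Under {C c} (X : Top C c) = Boundary (z X) (iz X) (iz-into X)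

  top-above-leaf : ∀ {C c} (X : Top C c) {i} → Reach T c (labT i) → Reach S (z X) (lab i)
  top-above-leaf X {i} c⇝i = subst (Reach S (z X)) (φ-label i) (z-above X S.◅◅ reach-φ c⇝i)

  good-under-top : ∀ {C c} (X : Top C c) {v w} → Good C v → Reach S (z X) w → Reach S v w → Reach S (z X) v
  good-under-top X good z⇝w v⇝w with S.ancestors-comparable z⇝w v⇝w
  ... | inj₁ z⇝v = z⇝v
  ... | inj₂ v⇝z = subst (Reach S (z X)) (sym (good-above-top X good v⇝z)) here

  module FAPair (C : Character s) (c₁ c₂ : Node T) (c₁≢c₂ : c₁ ≢ c₂)
                (pair : FAIsPair T labT C c₁ c₂) (explained : ExplainsChar G sel lab C) where

    fa₁ : IsFA T labT C c₁
    fa₁ = proj₂ (pair c₁) (inj₁ refl)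

    fa₂ : IsFA T labT C c₂
    fa₂ = proj₂ (pair c₂) (inj₂ refl)

    incomparable : ¬ Comparable T c₁ c₂
    incomparable (inj₁ c₂⇝c₁) = FA-incomparable fa₂ fa₁ (λ c₂≡c₁ → c₁≢c₂ (sym c₂≡c₁)) c₂⇝c₁
    incomparable (inj₂ c₁⇝c₂) = FA-incomparable fa₁ fa₂ c₁≢c₂ c₁⇝c₂

    parent₁ : ∃ λ e → tgt T e ≡ c₁
    parent₁ = incomparable⇒parent (λ c₁⇝c₂ → incomparable (inj₂ c₁⇝c₂))

    parent₂ : ∃ λ e → tgt T e ≡ c₂
    parent₂ = incomparable⇒parent (λ c₂⇝c₁ → incomparable (inj₁ c₂⇝c₁))

    top₁ : Top C c₁
    top₁ = top fa₁ parent₁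

    top₂ : Top C c₂
    top₂ = top fa₂ parent₂

    module D₁ = Under top₁
    module D₂ = Under top₂

    disjoint : ∀ {v} → D₁.Below v → ¬ D₂.Below v
    disjoint in₁ in₂ = incomparable (tops-overlap⇒comparable top₁ top₂ in₁ in₂)

    disjoint-sym : ∀ {v} → D₂.Below v → ¬ D₁.Below v
    disjoint-sym in₂ in₁ = disjoint in₁ in₂

    -- a good node lies above a leaf, whose first-appearance ancestor is c₁ or c₂
    cover : ∀ {v} → Good C v → D₁.Below v ⊎ D₂.Below v
    cover {v} good =
      let w , v⇝w , sink = S.reach-sink v
          x , φx≡w       = φ-onto w λ subdiv → 0≢1 (trans (sym sink) (proj₂ subdiv))
          v⇝x            = subst (Reach S v) (sym φx≡w) v⇝w
          f , fa , f⇝x   = FA-above (good⇒leaves-in (good-below good v⇝x))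
      in under-first-appearance v⇝x f⇝x (proj₁ (pair f) fa)
      where
      0≢1 : 0 ≢ 1
      0≢1 ()
      under-first-appearance : ∀ {f x} → Reach S v (φ x) → Reach T f x → f ≡ c₁ ⊎ f ≡ c₂ →
                               D₁.Below v ⊎ D₂.Below v
      under-first-appearance v⇝x f⇝x (inj₁ refl) = inj₁ (good-under-top top₁ good (z-above top₁ S.◅◅ reach-φ f⇝x) v⇝x)
      under-first-appearance v⇝x f⇝x (inj₂ refl) = inj₂ (good-under-top top₂ good (z-above top₂ S.◅◅ reach-φ f⇝x) v⇝x)

    not-D₁⇒D₂ : ∀ {v} → D₁.Below v ⊎ D₂.Below v → ¬ D₁.Below v → D₂.Below v
    not-D₁⇒D₂ (inj₁ in₁) ∉₁ = ⊥-elim (∉₁ in₁)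
    not-D₁⇒D₂ (inj₂ in₂) _  = in₂

    in-C : ∀ {c} → IsFA T labT C c → ∀ {i} → Reach T c (labT i) → i ∈ C
    in-C fa c⇝i = proj₁ fa _ c⇝i

    leaf₁ : ∃ λ i → Reach T c₁ (labT i)
    leaf₁ = leaf-below parent₁

    leaf₂ : ∃ λ i → Reach T c₂ (labT i)
    leaf₂ = leaf-below parent₂

    w : Node G
    w = proj₁ explained

    path : ∀ i → i ∈ C → ReachIn G (Good C) w (lab i)
    path = proj₂ (proj₂ explained)

    path₁ : ReachIn G (Good C) w (lab (proj₁ leaf₁))
    path₁ = path _ (in-C fa₁ (proj₂ leaf₁))

    path₂ : ReachIn G (Good C) w (lab (proj₁ leaf₂))
    path₂ = path _ (in-C fa₂ (proj₂ leaf₂))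

    leaf₁-below : D₁.Below (lab (proj₁ leaf₁))
    leaf₁-below = top-above-leaf top₁ (proj₂ leaf₁)

    leaf₂-outside : ¬ D₁.Below (lab (proj₁ leaf₂))
    leaf₂-outside in₁ = disjoint in₁ (top-above-leaf top₂ (proj₂ leaf₂))

    -- the explanation reaches both leaves along good nodes, hence passes between D₁ and D₂
    bridge : ∃ λ t → Transfer t × Between D₁.Below D₂.Below t
    bridge with D₁.Below? w
    ... | yes w∈ = from-inside w∈
      where
      from-inside : D₁.Below w → ∃ λ t → Transfer t × Between D₁.Below D₂.Below t
      from-inside w∈ =
        let t , transfer , (s∈₁ , t∉₁) , rest = D₁.leave path₂ w∈ leaf₂-outside
        in t , transfer , forward s∈₁ (not-D₁⇒D₂ (cover (reachIn-start rest)) t∉₁)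
    ... | no  w∉ = from-outside w∉
      where
      from-outside : ¬ D₁.Below w → ∃ λ t → Transfer t × Between D₁.Below D₂.Below t
      from-outside w∉ =
        let t , transfer , (s∉₁ , t∈₁) , s-good , _ = D₁.enter (parent-bad top₁) path₁ w∉ leaf₁-below
        in t , transfer , backward t∈₁ (not-D₁⇒D₂ (cover s-good) s∉₁)

    exits⇒explainer-below : ∀ {t} → Transfer t → D₁.Exits t → D₁.Below w
    exits⇒explainer-below transfer exits@(s∈₁ , _) = decidable-stable (D₁.Below? w) λ w∉ →
      proj₁ (proj₁ (D₁.only-entry (parent-bad top₁) transfer (inj₁ exits) path₁ w∉ leaf₁-below)) s∈₁

    enters⇒explainer-outside : ∀ {t} → Transfer t → D₁.Enters t → ¬ D₁.Below w
    enters⇒explainer-outside transfer enters@(s∉₁ , _) w∈ =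
      s∉₁ (proj₁ (proj₁ (D₁.only-exit transfer (inj₂ enters) path₂ w∈ leaf₂-outside)))

    via-exit : ∀ {t i} → Transfer t → D₁.Exits t → i ∈ C → ¬ D₁.Below (lab i) → ReachIn G (Good C) (tgt G t) (lab i)
    via-exit transfer exits i∈C i∉₁ =
      proj₂ (D₁.only-exit transfer (inj₁ exits) (path _ i∈C) (exits⇒explainer-below transfer exits) i∉₁)

    via-entry : ∀ {t i} → Transfer t → D₁.Enters t → i ∈ C → D₁.Below (lab i) → ReachIn G (Good C) (tgt G t) (lab i)
    via-entry transfer enters i∈C i∈₁ =
      proj₂ (D₁.only-entry (parent-bad top₁) transfer (inj₂ enters) (path _ i∈C) (enters⇒explainer-outside transfer enters) i∈₁)

    -- the explanation of C would have to leave Z again after entering it through t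
    leaving-D₁-into : ∀ {C′ c′} (Z : Top C′ c′) {t} → Transfer t → D₁.Below (src G t) → D₂.Below (tgt G t) →
                      Under.Enters Z t → c₂ ≢ c′ → ¬ Reach T c₂ c′
    leaving-D₁-into Z transfer s∈₁ t∈₂ enters c₂≢c′ c₂⇝c′ =
      let i , c₂⇝i , c′⇏i = leaf-off-path c₂≢c′ c₂⇝c′ parent₂
      in Under.no-return Z transfer enters
           (via-exit transfer (s∈₁ , disjoint-sym t∈₂) (in-C fa₂ c₂⇝i) (disjoint-sym (top-above-leaf top₂ c₂⇝i)))
           (λ i∈Z → c′⇏i (top-leaf Z i∈Z))

  FA⊆⇒⊆ : ∀ {C C′} → (∀ f → IsFA T labT C f → IsFA T labT C′ f) → C ⊆ C′
  FA⊆⇒⊆ FA⊆ i∈C with FA-above (leaf-in i∈C)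
  ... | f , fa , f⇝i = proj₁ (FA⊆ f fa) _ f⇝i

  module TwoCharacters (A B : Character s) (a₁ a₂ b₁ b₂ : Node T) (a₁≢a₂ : a₁ ≢ a₂) (b₁≢b₂ : b₁ ≢ b₂)
                       (pairA : FAIsPair T labT A a₁ a₂) (pairB : FAIsPair T labT B b₁ b₂)
                       (explainedA : ExplainsChar G sel lab A) (explainedB : ExplainsChar G sel lab B) where

    module 𝐀 = FAPair A a₁ a₂ a₁≢a₂ pairA explainedA
    module 𝐁 = FAPair B b₁ b₂ b₁≢b₂ pairB explainedB

    -- when the first subtrees meet, both bridges are the edge crossing the larger of them
    shared-bridge : (∀ {v} → 𝐀.D₂.Below v → ¬ 𝐁.D₁.Below v) → (∀ {v} → 𝐁.D₂.Below v → ¬ 𝐀.D₁.Below v) →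
                    ∀ {v} → 𝐀.D₁.Below v → 𝐁.D₁.Below v →
                    ∃ λ t → Transfer t × Between (𝐀.D₁.Below ∩ 𝐁.D₁.Below) (𝐀.D₂.Below ∩ 𝐁.D₂.Below) t
    shared-bridge A₂∌B₁ B₂∌A₁ inA inB =
      let tA , transferA , betweenA = 𝐀.bridge
          tB , transferB , betweenB = 𝐁.bridge
      in tA , transferA , between-∩ A₂∌B₁ B₂∌A₁ betweenA
                            (subst (Between 𝐁.D₁.Below 𝐁.D₂.Below) (sym (same transferA transferB betweenA betweenB)) betweenB)
      where
      same : ∀ {tA tB} → Transfer tA → Transfer tB →
             Between 𝐀.D₁.Below 𝐀.D₂.Below tA → Between 𝐁.D₁.Below 𝐁.D₂.Below tB → tA ≡ tB
      same transferA transferB betweenA betweenB with S.ancestors-comparable inA inB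
      ... | inj₁ zA⇝zB = 𝐀.D₁.crossing-unique transferA transferB
                           (𝐀.D₁.between⇒crosses (λ in₁ → in₁) 𝐀.disjoint-sym betweenA)
                           (𝐀.D₁.between⇒crosses (zA⇝zB S.◅◅_) B₂∌A₁ betweenB)
      ... | inj₂ zB⇝zA = 𝐁.D₁.crossing-unique transferA transferB
                           (𝐁.D₁.between⇒crosses (zB⇝zA S.◅◅_) A₂∌B₁ betweenA)
                           (𝐁.D₁.between⇒crosses (λ in₁ → in₁) 𝐁.disjoint-sym betweenB)

    b₁≺a₁⇒a₂≡b₂ : Prec T b₁ a₁ → ¬ Comparable T b₂ a₁ → a₂ ≡ b₂
    b₁≺a₁⇒a₂≡b₂ (a₁⇝b₁ , b₁≢a₁) b₂∦a₁ =
      settle (shared-bridge A₂∌B₁ B₂∌A₁ (z-above 𝐀.top₁ S.◅◅ reach-φ a₁⇝b₁) (z-above 𝐁.top₁))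
      where
      A₂∌B₁ : ∀ {v} → 𝐀.D₂.Below v → ¬ 𝐁.D₁.Below v
      A₂∌B₁ in₂ in₁ with tops-overlap⇒comparable 𝐀.top₂ 𝐁.top₁ in₂ in₁
      ... | inj₁ b₁⇝a₂ = 𝐀.incomparable (inj₂ (a₁⇝b₁ T.◅◅ b₁⇝a₂))
      ... | inj₂ a₂⇝b₁ = 𝐀.incomparable (swap (T.ancestors-comparable a₁⇝b₁ a₂⇝b₁))
      B₂∌A₁ : ∀ {v} → 𝐁.D₂.Below v → ¬ 𝐀.D₁.Below v
      B₂∌A₁ in₂ in₁ = b₂∦a₁ (tops-overlap⇒comparable 𝐁.top₂ 𝐀.top₁ in₂ in₁)
      settle : (∃ λ t → Transfer t × Between (𝐀.D₁.Below ∩ 𝐁.D₁.Below) (𝐀.D₂.Below ∩ 𝐁.D₂.Below) t) → a₂ ≡ b₂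
      -- a leaf of A below a₁ but not below b₁ is reached through t, which enters D₁ of B
      settle (t , transfer , backward (tA₁ , tB₁) (sA₂ , sB₂)) =
        let i , a₁⇝i , b₁⇏i = leaf-off-path (λ a₁≡b₁ → b₁≢a₁ (sym a₁≡b₁)) a₁⇝b₁ 𝐀.parent₁
        in ⊥-elim (𝐁.D₁.no-return transfer (𝐁.disjoint-sym sB₂ , tB₁)
                     (𝐀.via-entry transfer (𝐀.disjoint-sym sA₂ , tA₁) (𝐀.in-C 𝐀.fa₁ a₁⇝i) (top-above-leaf 𝐀.top₁ a₁⇝i))
                     (λ i∈B₁ → b₁⇏i (top-leaf 𝐁.top₁ i∈B₁)))
      settle (t , transfer , forward (sA₁ , sB₁) (tA₂ , tB₂)) with a₂ ≟ b₂
      ... | yes a₂≡b₂ = a₂≡b₂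
      ... | no  a₂≢b₂ with tops-overlap⇒comparable 𝐀.top₂ 𝐁.top₂ tA₂ tB₂
      ...   | inj₂ a₂⇝b₂ = ⊥-elim (𝐀.leaving-D₁-into 𝐁.top₂ transfer sA₁ tA₂ (𝐁.disjoint sB₁ , tB₂) a₂≢b₂ a₂⇝b₂)
      ...   | inj₁ b₂⇝a₂ = ⊥-elim (𝐁.leaving-D₁-into 𝐀.top₂ transfer sB₁ tB₂ (𝐀.disjoint sA₁ , tA₂)
                                      (λ b₂≡a₂ → a₂≢b₂ (sym b₂≡a₂)) b₂⇝a₂)

    a₁≡b₁⇒nested : A ≢ B → a₁ ≡ b₁ → Prec T b₂ a₂ ⊎ Prec T a₂ b₂
    a₁≡b₁⇒nested A≢B refl =
      let _ , _ , between = shared-bridge A₂∌B₁ B₂∌A₁ (z-above 𝐀.top₁) (z-above 𝐁.top₁)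
          _ , inA₂ , inB₂ = second-ends between
      in nested (tops-overlap⇒comparable 𝐀.top₂ 𝐁.top₂ inA₂ inB₂)
      where
      A₂∌B₁ : ∀ {v} → 𝐀.D₂.Below v → ¬ 𝐁.D₁.Below v
      A₂∌B₁ in₂ in₁ = 𝐀.incomparable (swap (tops-overlap⇒comparable 𝐀.top₂ 𝐁.top₁ in₂ in₁))
      B₂∌A₁ : ∀ {v} → 𝐁.D₂.Below v → ¬ 𝐀.D₁.Below v
      B₂∌A₁ in₂ in₁ = 𝐁.incomparable (swap (tops-overlap⇒comparable 𝐁.top₂ 𝐀.top₁ in₂ in₁))
      second-ends : ∀ {X Y : Pred (Node G) _} {t} → Between X Y t → ∃ Y
      second-ends (forward _ y)  = _ , y
      second-ends (backward _ y) = _ , y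
      a₂≢b₂ : a₂ ≢ b₂
      a₂≢b₂ refl = A≢B (⊆-antisym (FA⊆⇒⊆ λ f → proj₂ (pairB f) ∘ proj₁ (pairA f))
                                  (FA⊆⇒⊆ λ f → proj₂ (pairA f) ∘ proj₁ (pairB f)))
      nested : Comparable T a₂ b₂ → Prec T b₂ a₂ ⊎ Prec T a₂ b₂
      nested (inj₁ b₂⇝a₂) = inj₂ (b₂⇝a₂ , a₂≢b₂)
      nested (inj₂ a₂⇝b₂) = inj₁ (a₂⇝b₂ , λ b₂≡a₂ → a₂≢b₂ (sym b₂≡a₂))

lemma6 : (T : Digraph) (s : ℕ) (labT : Fin s → Node T) (𝒞 : Character s → Set) →
         IsTree T → HasLeafSet T s labT → (∀ v → ¬ IsSubdiv T v) →
         GalledCompletable T s labT 𝒞 →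
         (A B : Character s) → 𝒞 A → 𝒞 B → A ≢ B →
         (a₁ a₂ b₁ b₂ : Node T) → a₁ ≢ a₂ → b₁ ≢ b₂ →
         FAIsPair T labT A a₁ a₂ → FAIsPair T labT B b₁ b₂ →
         ((Prec T b₁ a₁ → ¬ Comparable T b₂ a₁ → a₂ ≡ b₂) ×
          (a₁ ≡ b₁ → Prec T b₂ a₂ ⊎ Prec T a₂ b₂))
lemma6 T s labT 𝒞 tree leaves no-subdivision (G , sel , lab , lgt , galled , _ , sup , explains)
       A B A∈𝒞 B∈𝒞 A≢B a₁ a₂ b₁ b₂ a₁≢a₂ b₁≢b₂ pairA pairB =
  b₁≺a₁⇒a₂≡b₂ , a₁≡b₁⇒nested A≢B
  where
  open Completion T s labT tree leaves no-subdivision G sel lab lgt galled sup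
  open TwoCharacters A B a₁ a₂ b₁ b₂ a₁≢a₂ b₁≢b₂ pairA pairB (explains A A∈𝒞) (explains B B∈𝒞)
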